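{- Let $\Gamma$ be a $G$-symmetric graph and $\mathcal{B}$ a $G$-invariant partition of $V\Gamma$, with quotient graph $\Gamma_{\mathcal{B}}$. Suppose that for some block $B\in\mathcal{B}$ the actions of the setwise stabilizer $G_B$ on $B$ and on $\Gamma_{\mathcal{B}}(B)$ (the set of neighbours of $B$ in $\Gamma_{\mathcal{B}}$) are permutation equivalent. Then the action of $G$ on the vertex set of $\Gamma$ is permutation equivalent to the action of $G$ on the arc set of $\Gamma_{\mathcal{B}}$.
   Context: A graph is $G$-symmetric if $G$ acts on it by automorphisms transitively on its vertices and on its arcs (ordered pairs of adjacent vertices). A partition $\mathcal{B}$ of $V\Gamma$ is $G$-invariant if $B^g\in\mathcal{B}$ for all $B\in\mathcal{B}$, $g\in G$. The quotient graph $\Gamma_{\mathcal{B}}$ has vertex set $\mathcal{B}$, with $B,C$ adjacent iff some vertex of $B$ is adjacent in $\Gamma$ to some vertex of $C$; $G$ acts on arcs of $\Gamma_{\mathcal{B}}$ by $(B,C)^g=(B^g,C^g)$. Two actions of the same group $H$ on sets $X,Y$ are permutation equivalent if there is a bijection $\rho:X\to Y$ with $\rho(x^h)=\rho(x)^h$ for all $x\in X$, $h\in H$. -}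

module Defs where

open import Level using (Level; _⊔_; 0ℓ) renaming (suc to lsuc)
open import Algebra.Bundles using (Group)
open import Relation.Binary.Bundles using (Setoid)
open import Relation.Binary.Structures using (IsEquivalence)
open import Relation.Binary.PropositionalEquality as ≡ using (_≡_; refl)
open import Function.Bundles using (Bijection; _⇔_; Equivalence)
open import Data.Product using (Σ; ∃; _×_; _,_; proj₁; proj₂)
open import Data.Unit using (⊤; tt)
open import Relation.Nullary using (¬_)

module _ {c ℓ} (G : Group c ℓ) where
  open Group G using (Carrier; _≈_; _∙_; ε)

  PermEquivalent : ∀ {p a e b f} (H : Carrier → Set p)
    (X : Setoid a e) (Y : Setoid b f)
    (actX : Setoid.Carrier X → (h : Carrier) → H h → Setoid.Carrier X)
    (actY : Setoid.Carrier Y → (h : Carrier) → H h → Setoid.Carrier Y) →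
    Set (c ⊔ p ⊔ a ⊔ e ⊔ b ⊔ f)
  PermEquivalent H X Y actX actY =
    Σ (Bijection X Y) λ ρ → ∀ x h (hH : H h) →
      Setoid._≈_ Y (Bijection.to ρ (actX x h hH)) (actY (Bijection.to ρ x) h hH)

  -- The partition is given by its equivalence relation
  -- _∼_ ("lies in the same block"); a block is an equivalence class.
  record SymGraphPartition : Set (c ⊔ ℓ ⊔ lsuc 0ℓ) where
    infixl 7 _·_
    field
      V    : Set
      Adj  : V → V → Set
      Adj-sym    : ∀ {x y} → Adj x y → Adj y x
      Adj-irrefl : ∀ {x} → ¬ Adj x x
      _·_        : V → Carrier → V
      ·-cong     : ∀ x {g h} → g ≈ h → x · g ≡ x · h
      ·-identity : ∀ x → x · ε ≡ x
      ·-assoc    : ∀ x g h → x · g · h ≡ x · (g ∙ h)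
      ·-auto     : ∀ x y g → Adj x y ⇔ Adj (x · g) (y · g)
      vertex-transitive : ∀ x y → ∃ λ g → x · g ≡ y
      arc-transitive : ∀ {x y x′ y′} → Adj x y → Adj x′ y′ →
                       ∃ λ g → (x · g ≡ x′) × (y · g ≡ y′)
      _∼_       : V → V → Set
      ∼-isEquiv : IsEquivalence _∼_
      ∼-inv     : ∀ {x y} g → x ∼ y → (x · g) ∼ (y · g)

  module Quotient (S : SymGraphPartition) where
    open SymGraphPartition S
    open IsEquivalence ∼-isEquiv renaming (refl to ∼-refl; sym to ∼-sym; trans to ∼-trans)

    QAdj : V → V → Set
    QAdj x y = ∃ λ x′ → ∃ λ y′ → (x′ ∼ x) × (y′ ∼ y) × Adj x′ y′

    QAdj-respˡ : ∀ {x x₁ y} → x ∼ x₁ → QAdj x y → QAdj x₁ y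
    QAdj-respˡ p (x′ , y′ , q , r , a) = x′ , y′ , ∼-trans q p , r , a

    QAdj-act : ∀ {x y} g → QAdj x y → QAdj (x · g) (y · g)
    QAdj-act g (x′ , y′ , q , r , a) =
      x′ · g , y′ · g , ∼-inv g q , ∼-inv g r , Equivalence.to (·-auto x′ y′ g) a

    VSetoid : Setoid 0ℓ 0ℓ
    VSetoid = ≡.setoid V

    actV : V → (g : Carrier) → ⊤ → V
    actV x g _ = x · g

    -- the arc set of Γ_𝓑: ordered pairs (B , C) of adjacent blocks,
    -- blocks compared up to equality of blocks (i.e. ∼ on representatives)
    QArcSetoid : Setoid 0ℓ 0ℓ
    QArcSetoid = record
      { Carrier = Σ (V × V) (λ p → QAdj (proj₁ p) (proj₂ p))
      ; _≈_ = λ a b → (proj₁ (proj₁ a) ∼ proj₁ (proj₁ b)) × (proj₂ (proj₁ a) ∼ proj₂ (proj₁ b))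
      ; isEquivalence = record
        { refl = ∼-refl , ∼-refl
        ; sym = λ (p , q) → ∼-sym p , ∼-sym q
        ; trans = λ (p , q) (p′ , q′) → ∼-trans p p′ , ∼-trans q q′
        }
      }

    actQArc : Setoid.Carrier QArcSetoid → (g : Carrier) → ⊤ → Setoid.Carrier QArcSetoid
    actQArc ((x , y) , a) g _ = (x · g , y · g) , QAdj-act g a

    -- setwise stabiliser G_B of the block B containing b
    Stab : V → Carrier → Set
    Stab b g = (b · g) ∼ b

    BlockSetoid : V → Setoid 0ℓ 0ℓ
    BlockSetoid b = record
      { Carrier = Σ V (λ x → x ∼ b)
      ; _≈_ = λ u v → proj₁ u ≡ proj₁ v
      ; isEquivalence = record { refl = ≡.refl ; sym = ≡.sym ; trans = ≡.trans }
      }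

    actBlock : (b : V) → Setoid.Carrier (BlockSetoid b) → (g : Carrier) → Stab b g →
               Setoid.Carrier (BlockSetoid b)
    actBlock b (x , p) g s = x · g , ∼-trans (∼-inv g p) s

    -- Γ_𝓑(B): the blocks adjacent to B in Γ_𝓑 (blocks compared via ∼)
    NbrSetoid : V → Setoid 0ℓ 0ℓ
    NbrSetoid b = record
      { Carrier = Σ V (λ y → QAdj b y)
      ; _≈_ = λ u v → proj₁ u ∼ proj₁ v
      ; isEquivalence = record { refl = ∼-refl ; sym = ∼-sym ; trans = ∼-trans }
      }

    actNbr : (b : V) → Setoid.Carrier (NbrSetoid b) → (g : Carrier) → Stab b g →
             Setoid.Carrier (NbrSetoid b)
    actNbr b (y , a) g s = y · g , QAdj-respˡ s (QAdj-act g a)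

-- The vertex stabiliser G_b equals the stabiliser of the arc (B , C) of Γ_𝓑,
-- where C = ρ(b) for the given equivalence ρ : B → Γ_𝓑(B): an element of G_B
-- fixes b iff it fixes ρ(b), as ρ is G_B-equivariant and injective.  Since G is
-- transitive on VΓ and (by arc-transitivity of Γ) on the arcs of Γ_𝓑, both
-- actions are the coset action on G_b, and b · g ↦ (B , C) · g is the equivalence.
module Submission where

open import Defs
open import Level using (_⊔_)
open import Algebra.Bundles using (Group)
open import Data.Unit using (⊤; tt)
open import Data.Product using (∃; _×_; _,_; proj₁; proj₂)
open import Relation.Binary.PropositionalEquality using (_≡_; refl)
open import Relation.Binary.Structures using (IsEquivalence)
open import Relation.Binary.Bundles using (Setoid)
open import Function.Bundles using (Bijection; _⇔_; mk⇔; Equivalence)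
import Relation.Binary.Reasoning.Setoid as SetoidReasoning

module _ {c ℓ} (G : Group c ℓ) where
  open Group G using (Carrier; _≈_; _∙_; ε; _⁻¹; assoc; ∙-congˡ; inverseˡ; inverseʳ; identityʳ)
    renaming (refl to ≈-refl; sym to ≈-sym; trans to ≈-trans)

  record RightAction {a e} (X : Setoid a e) : Set (c ⊔ ℓ ⊔ a ⊔ e) where
    open Setoid X using () renaming (Carrier to X₀; _≈_ to _≈X_; refl to X-refl; sym to X-sym)
    infixl 7 _⊙_
    field
      _⊙_        : X₀ → Carrier → X₀
      ⊙-cong     : ∀ {x y g h} → x ≈X y → g ≈ h → x ⊙ g ≈X y ⊙ h
      ⊙-identity : ∀ x → x ⊙ ε ≈X x
      ⊙-assoc    : ∀ x g h → x ⊙ g ⊙ h ≈X x ⊙ (g ∙ h)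

    ≈⇒fixed : ∀ {x g h} → x ⊙ g ≈X x ⊙ h → x ⊙ (g ∙ h ⁻¹) ≈X x
    ≈⇒fixed {x} {g} {h} e = begin
      x ⊙ (g ∙ h ⁻¹)  ≈⟨ X-sym (⊙-assoc x g (h ⁻¹)) ⟩
      x ⊙ g ⊙ h ⁻¹    ≈⟨ ⊙-cong e ≈-refl ⟩
      x ⊙ h ⊙ h ⁻¹    ≈⟨ ⊙-assoc x h (h ⁻¹) ⟩
      x ⊙ (h ∙ h ⁻¹)  ≈⟨ ⊙-cong X-refl (inverseʳ h) ⟩
      x ⊙ ε           ≈⟨ ⊙-identity x ⟩
      x               ∎
      where open SetoidReasoning X

    fixed⇒≈ : ∀ {x g h} → x ⊙ (g ∙ h ⁻¹) ≈X x → x ⊙ g ≈X x ⊙ h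
    fixed⇒≈ {x} {g} {h} e = begin
      x ⊙ g                ≈⟨ ⊙-cong X-refl g≈gh⁻¹h ⟩
      x ⊙ ((g ∙ h ⁻¹) ∙ h) ≈⟨ X-sym (⊙-assoc x (g ∙ h ⁻¹) h) ⟩
      x ⊙ (g ∙ h ⁻¹) ⊙ h   ≈⟨ ⊙-cong e ≈-refl ⟩
      x ⊙ h                ∎
      where
      open SetoidReasoning X
      g≈gh⁻¹h : g ≈ (g ∙ h ⁻¹) ∙ h
      g≈gh⁻¹h = ≈-sym (≈-trans (assoc g (h ⁻¹) h) (≈-trans (∙-congˡ (inverseˡ h)) (identityʳ g)))

  module _ {a e b f} {X : Setoid a e} {Y : Setoid b f}
           (A : RightAction X) (B : RightAction Y)
           (x₀ : Setoid.Carrier X) (y₀ : Setoid.Carrier Y) where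
    open Setoid X using () renaming (_≈_ to _≈X_; trans to X-trans; sym to X-sym)
    open Setoid Y using () renaming (_≈_ to _≈Y_; trans to Y-trans; sym to Y-sym)
    open RightAction A using () renaming (_⊙_ to _⊙X_; ⊙-assoc to ⊙X-assoc)
    open RightAction B using () renaming (_⊙_ to _⊙Y_; ⊙-assoc to ⊙Y-assoc)

    orbitsPermEquivalent :
      (X-transitive : ∀ x → ∃ λ g → x₀ ⊙X g ≈X x) →
      (Y-transitive : ∀ y → ∃ λ g → y₀ ⊙Y g ≈Y y) →
      (sameStabiliser : ∀ g → (x₀ ⊙X g ≈X x₀) ⇔ (y₀ ⊙Y g ≈Y y₀)) →
      PermEquivalent G (λ _ → ⊤) X Y (λ x g _ → x ⊙X g) (λ y g _ → y ⊙Y g)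
    orbitsPermEquivalent X-transitive Y-transitive sameStabiliser =
      record { to = φ ; cong = φ-cong ; bijective = φ-injective , φ-surjective }
      , λ x h _ → φ-equivariant x h
      where
      to-Y : ∀ {g h} → x₀ ⊙X g ≈X x₀ ⊙X h → y₀ ⊙Y g ≈Y y₀ ⊙Y h
      to-Y e = RightAction.fixed⇒≈ B (Equivalence.to (sameStabiliser _) (RightAction.≈⇒fixed A e))

      from-Y : ∀ {g h} → y₀ ⊙Y g ≈Y y₀ ⊙Y h → x₀ ⊙X g ≈X x₀ ⊙X h
      from-Y e = RightAction.fixed⇒≈ A (Equivalence.from (sameStabiliser _) (RightAction.≈⇒fixed B e))

      γ : Setoid.Carrier X → Carrier
      γ x = proj₁ (X-transitive x)

      γ-spec : ∀ x → x₀ ⊙X γ x ≈X x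
      γ-spec x = proj₂ (X-transitive x)

      φ : Setoid.Carrier X → Setoid.Carrier Y
      φ x = y₀ ⊙Y γ x

      φ-cong : ∀ {x x′} → x ≈X x′ → φ x ≈Y φ x′
      φ-cong {x} {x′} e = to-Y (X-trans (γ-spec x) (X-trans e (X-sym (γ-spec x′))))

      φ-injective : ∀ {x x′} → φ x ≈Y φ x′ → x ≈X x′
      φ-injective {x} {x′} e = X-trans (X-sym (γ-spec x)) (X-trans (from-Y e) (γ-spec x′))

      φ-surjective : ∀ y → ∃ λ x → ∀ {z} → z ≈X x → φ z ≈Y y
      φ-surjective y with Y-transitive y
      ... | g , y₀g≈y = x₀ ⊙X g , λ {z} e → Y-trans (to-Y (X-trans (γ-spec z) e)) y₀g≈y

      φ-equivariant : ∀ x h → φ (x ⊙X h) ≈Y φ x ⊙Y h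
      φ-equivariant x h = Y-trans (to-Y x₀γxh≈x₀γx∙h) (Y-sym (⊙Y-assoc y₀ (γ x) h))
        where
        x₀γxh≈x₀γx∙h : x₀ ⊙X γ (x ⊙X h) ≈X x₀ ⊙X (γ x ∙ h)
        x₀γxh≈x₀γx∙h = X-trans (γ-spec (x ⊙X h))
          (X-trans (RightAction.⊙-cong A (X-sym (γ-spec x)) ≈-refl) (⊙X-assoc x₀ (γ x) h))

  module _ (S : SymGraphPartition G) where
    open SymGraphPartition S
    open Quotient G S
    open IsEquivalence ∼-isEquiv
      renaming (refl to ∼-refl; sym to ∼-sym; trans to ∼-trans; reflexive to ∼-reflexive)

    vertexAction : RightAction VSetoid
    vertexAction = record
      { _⊙_        = _·_
      ; ⊙-cong     = λ { {x} refl g≈h → ·-cong x g≈h }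
      ; ⊙-identity = ·-identity
      ; ⊙-assoc    = ·-assoc
      }

    quotientArcAction : RightAction QArcSetoid
    quotientArcAction = record
      { _⊙_        = λ arc g → actQArc arc g tt
      ; ⊙-cong     = λ { {(x , y) , _} {(x′ , y′) , _} {g} (x∼x′ , y∼y′) g≈h →
                         ∼-trans (∼-inv g x∼x′) (∼-reflexive (·-cong x′ g≈h))
                       , ∼-trans (∼-inv g y∼y′) (∼-reflexive (·-cong y′ g≈h)) }
      ; ⊙-identity = λ { ((x , y) , _) → ∼-reflexive (·-identity x) , ∼-reflexive (·-identity y) }
      ; ⊙-assoc    = λ { ((x , y) , _) g h → ∼-reflexive (·-assoc x g h) , ∼-reflexive (·-assoc y g h) }
      }

    quotient-arc-transitive : ∀ {x y x′ y′} → QAdj x y → QAdj x′ y′ →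
                              ∃ λ g → ((x · g) ∼ x′) × ((y · g) ∼ y′)
    quotient-arc-transitive (u , v , u∼x , v∼y , uv) (u′ , v′ , u′∼x′ , v′∼y′ , u′v′)
      with arc-transitive uv u′v′
    ... | g , ug≡u′ , vg≡v′ =
      g , ∼-trans (∼-inv g (∼-sym u∼x)) (∼-trans (∼-reflexive ug≡u′) u′∼x′)
        , ∼-trans (∼-inv g (∼-sym v∼y)) (∼-trans (∼-reflexive vg≡v′) v′∼y′)

    module _ (b : V)
             (PE : PermEquivalent G (Stab b) (BlockSetoid b) (NbrSetoid b) (actBlock b) (actNbr b))
             where
      open Bijection (proj₁ PE) using () renaming (to to ρ; cong to ρ-cong; injective to ρ-injective)

      ρ-equivariant : ∀ x g (s : Stab b g) → proj₁ (ρ (actBlock b x g s)) ∼ (proj₁ (ρ x) · g)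
      ρ-equivariant = proj₂ PE

      b̂ : Setoid.Carrier (BlockSetoid b)
      b̂ = b , ∼-refl

      ρb : V
      ρb = proj₁ (ρ b̂)

      arc₀ : Setoid.Carrier QArcSetoid
      arc₀ = (b , ρb) , proj₂ (ρ b̂)

      vertexStab⇔arcStab : ∀ g → (b · g ≡ b) ⇔ (((b · g) ∼ b) × ((ρb · g) ∼ ρb))
      vertexStab⇔arcStab g = mk⇔ fixesArc fixesVertex
        where
        fixesArc : b · g ≡ b → ((b · g) ∼ b) × ((ρb · g) ∼ ρb)
        fixesArc bg≡b = ∼-reflexive bg≡b
                      , ∼-trans (∼-sym (ρ-equivariant b̂ g (∼-reflexive bg≡b))) (ρ-cong bg≡b)

        fixesVertex : ((b · g) ∼ b) × ((ρb · g) ∼ ρb) → b · g ≡ b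
        fixesVertex (bg∼b , ρbg∼ρb) =
          ρ-injective {actBlock b b̂ g bg∼b} {b̂} (∼-trans (ρ-equivariant b̂ g bg∼b) ρbg∼ρb)

mainTheorem4 : ∀ {c ℓ} (G : Group c ℓ) (S : SymGraphPartition G)
    (b : SymGraphPartition.V S) →
    PermEquivalent G (Quotient.Stab G S b)
    (Quotient.BlockSetoid G S b) (Quotient.NbrSetoid G S b)
    (Quotient.actBlock G S b) (Quotient.actNbr G S b) →
    PermEquivalent G (λ _ → ⊤)
    (Quotient.VSetoid G S) (Quotient.QArcSetoid G S)
    (Quotient.actV G S) (Quotient.actQArc G S)
mainTheorem4 G S b PE =
  orbitsPermEquivalent G (vertexAction G S) (quotientArcAction G S) b (arc₀ G S b PE)
    (SymGraphPartition.vertex-transitive S b)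
    (λ arc → quotient-arc-transitive G S (proj₂ (arc₀ G S b PE)) (proj₂ arc))
    (vertexStab⇔arcStab G S b PE)
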